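{- Let $m, n$ be positive integers and let $X$ be a binomial random variable with parameters $n$ and $\frac{1}{2}$. Then $\mathbb{P}(X \equiv 0 \pmod m) \leq \frac{1}{m} + \frac{2}{\sqrt{n}}$. -}

module Defs where

open import Data.Nat as ℕ using (ℕ; suc; _^_; NonZero)
open import Data.Nat.Properties using (m^n≢0)
open import Data.Nat.Divisibility using (_∣?_)
open import Data.Nat.Combinatorics using (_C_)
open import Data.Integer using (+_)
open import Data.Rational using (ℚ; _/_; _+_; _*_; _-_; _≤_; 0ℚ)
open import Data.List using (List; upTo; map; foldr)
open import Data.Sum using (_⊎_)
open import Relation.Nullary using (does)
open import Data.Bool using (if_then_else_)

binomPMF : ℕ → ℕ → ℚ
binomPMF n k = _/_ (+ (n C k)) (2 ^ n) {{m^n≢0 2 n}}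

sumℚ : List ℚ → ℚ
sumℚ = foldr _+_ 0ℚ

probDiv : ℕ → ℕ → ℚ
probDiv m n = sumℚ (map (λ k → if does (m ∣? k) then binomPMF n k else 0ℚ) (upTo (suc n)))

-- "x ≤ a / √n" for rational x, a ≥ 0 and n > 0, written without square roots:
-- either x ≤ 0, or x² · n ≤ a².
LeDivSqrt : ℚ → ℚ → ℕ → Set
LeDivSqrt x a n = (x ≤ 0ℚ) ⊎ (x * x * (+ n / 1) ≤ a * a)

{-# OPTIONS --safe #-}
-- The coefficients n C k increase up to h = ⌊n/2⌋ and decrease after it. Hence for every
-- residue r < m the terms n C (j m) sum to at most n C h more than the terms n C (j m + r).
-- Summing over r gives m S ≤ 2ⁿ + m (n C h) for the sum S of n C k over multiples k of m,
-- that is P(m ∣ X) - 1/m ≤ (n C h) / 2ⁿ. Finally (n C h)² n ≤ 4ⁿ follows from the central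
-- binomial estimate (2k C k)² (2k + 1) ≤ 16ᵏ.
module Submission where

open import Defs
open import Algebra.Properties.CommutativeSemigroup using (interchange; x∙yz≈y∙xz)
open import Data.Bool using (true; false; if_then_else_)
open import Data.Integer as ℤ using (+_; -[1+_]; _⊖_)
import Data.Integer.Properties as ℤP
import Data.Integer.Tactic.RingSolver as ℤSolver
open import Data.List using (applyUpTo)
open import Data.List.Properties using (map-upTo)
open import Data.Nat hiding (_/_)
open import Data.Nat.Combinatorics using (_C_; nCk+nC[k+1]≡[n+1]C[k+1]; nCk≡nC[n∸k]; nC1≡n; k>n⇒nCk≡0)
open import Data.Nat.Divisibility using (_∣?_; n∣m*n; ∣m+n∣m⇒∣n; ∣⇒≤)
open import Data.Nat.Properties
open import Data.Nat.Tactic.RingSolver using (solve-∀)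
open import Data.Rational as ℚ using (ℚ; _/_; _-_; toℚᵘ; 0ℚ)
import Data.Rational.Properties as ℚP
open import Data.Rational.Unnormalised as ℚᵘ using (mkℚᵘ; _≃_; *≡*; *≤*)
import Data.Rational.Unnormalised.Properties as ℚᵘP
open import Data.Sum as Sum using (_⊎_; inj₁; inj₂)
open import Function using (_∘_)
open import Relation.Nullary using (yes; no)
open import Relation.Nullary.Decidable using (does; dec-true; dec-false)
open import Relation.Binary.PropositionalEquality

open ≤-Reasoning

∑ : ℕ → (ℕ → ℕ) → ℕ
∑ zero    f = 0
∑ (suc N) f = f 0 + ∑ N (f ∘ suc)

∑-cong : ∀ N {f g : ℕ → ℕ} → (∀ {k} → k < N → f k ≡ g k) → ∑ N f ≡ ∑ N g
∑-cong zero    f≡g = refl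
∑-cong (suc N) f≡g = cong₂ _+_ (f≡g z<s) (∑-cong N (f≡g ∘ s<s))

∑-zero : ∀ N {f : ℕ → ℕ} → (∀ {k} → k < N → f k ≡ 0) → ∑ N f ≡ 0
∑-zero zero    f≡0 = refl
∑-zero (suc N) f≡0 = cong₂ _+_ (f≡0 z<s) (∑-zero N (f≡0 ∘ s<s))

∑-monoʳ-≤ : ∀ N {f g : ℕ → ℕ} → (∀ {k} → k < N → f k ≤ g k) → ∑ N f ≤ ∑ N g
∑-monoʳ-≤ zero    f≤g = z≤n
∑-monoʳ-≤ (suc N) f≤g = +-mono-≤ (f≤g z<s) (∑-monoʳ-≤ N (f≤g ∘ s<s))

∑-monoˡ-≤ : ∀ {N N′} f → N ≤ N′ → ∑ N f ≤ ∑ N′ f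
∑-monoˡ-≤ f z≤n         = z≤n
∑-monoˡ-≤ f (s≤s N≤N′) = +-monoʳ-≤ (f 0) (∑-monoˡ-≤ (f ∘ suc) N≤N′)

∑-const : ∀ N c → ∑ N (λ _ → c) ≡ N * c
∑-const zero    c = refl
∑-const (suc N) c = cong (_+_ c) (∑-const N c)

∑-distrib-+ : ∀ N f g → ∑ N (λ k → f k + g k) ≡ ∑ N f + ∑ N g
∑-distrib-+ zero    f g = refl
∑-distrib-+ (suc N) f g = trans (cong (_+_ (f 0 + g 0)) (∑-distrib-+ N (f ∘ suc) (g ∘ suc)))
                                (interchange +-commutativeSemigroup (f 0) (g 0) _ _)

∑-split : ∀ M N f → ∑ (M + N) f ≡ ∑ M f + ∑ N (λ k → f (M + k))
∑-split zero    N f = refl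
∑-split (suc M) N f = trans (cong (_+_ (f 0)) (∑-split M N (f ∘ suc))) (sym (+-assoc (f 0) _ _))

∑-extend : ∀ {N N′} f → (∀ {k} → N ≤ k → f k ≡ 0) → N ≤ N′ → ∑ N′ f ≡ ∑ N f
∑-extend {N′ = N′} f vanish z≤n = ∑-zero N′ (λ _ → vanish z≤n)
∑-extend f vanish (s≤s N≤N′)    = cong (_+_ (f 0)) (∑-extend (f ∘ suc) (vanish ∘ s≤s) N≤N′)

∑-residues : ∀ J m f → ∑ (J * m) f ≡ ∑ m (λ r → ∑ J (λ j → f (j * m + r)))
∑-residues zero    m f = sym (∑-zero m (λ _ → refl))
∑-residues (suc J) m f = begin-equality
  ∑ (m + J * m) f                                      ≡⟨ ∑-split m (J * m) f ⟩
  ∑ m f + ∑ (J * m) (λ k → f (m + k))                  ≡⟨ cong (_+_ (∑ m f)) (∑-residues J m (λ k → f (m + k))) ⟩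
  ∑ m f + ∑ m (λ r → ∑ J (λ j → f (m + (j * m + r))))  ≡⟨ cong (_+_ (∑ m f)) (∑-cong m λ {r} _ →
                                                            ∑-cong J λ {j} _ → cong f (sym (+-assoc m (j * m) r))) ⟩
  ∑ m f + ∑ m (λ r → ∑ J (λ j → f (suc j * m + r)))    ≡⟨ ∑-distrib-+ m f _ ⟨
  ∑ m (λ r → ∑ (suc J) (λ j → f (j * m + r)))          ∎

onMultiplesOf : ℕ → (ℕ → ℕ) → ℕ → ℕ
onMultiplesOf m f k = if does (m ∣? k) then f k else 0

onMultiplesOf-zero : ∀ m f k → f k ≡ 0 → onMultiplesOf m f k ≡ 0
onMultiplesOf-zero m f k fk≡0 with does (m ∣? k)
... | true  = fk≡0
... | false = refl

∑-onMultiplesOf : ∀ J m .{{_ : NonZero m}} f → ∑ (J * m) (onMultiplesOf m f) ≡ ∑ J (λ j → f (j * m))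
∑-onMultiplesOf J m@(suc m′) f = begin-equality
  ∑ (J * m) (onMultiplesOf m f)
    ≡⟨ ∑-residues J m _ ⟩
  ∑ J (λ j → onMultiplesOf m f (j * m + 0)) + ∑ m′ (λ r → ∑ J (λ j → onMultiplesOf m f (j * m + suc r)))
    ≡⟨ cong₂ _+_ (∑-cong J λ {j} _ → multiple j) (∑-zero m′ λ r<m′ → ∑-zero J λ {j} _ → nonMultiple j r<m′) ⟩
  ∑ J (λ j → f (j * m)) + 0
    ≡⟨ +-identityʳ _ ⟩
  ∑ J (λ j → f (j * m)) ∎
  where
  multiple : ∀ j → onMultiplesOf m f (j * m + 0) ≡ f (j * m)
  multiple j rewrite +-identityʳ (j * m) | dec-true (m ∣? j * m) (n∣m*n j) = refl
  nonMultiple : ∀ j {r} → r < m′ → onMultiplesOf m f (j * m + suc r) ≡ 0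
  nonMultiple j {r} r<m′
    rewrite dec-false (m ∣? j * m + suc r) (λ m∣ → <⇒≱ (s<s r<m′) (∣⇒≤ (∣m+n∣m⇒∣n m∣ (n∣m*n j)))) = refl

record Unimodal (a : ℕ → ℕ) (peak : ℕ) : Set where
  field
    ascending  : ∀ {k} → k < peak → a k ≤ a (suc k)
    descending : ∀ {k} → peak ≤ k → a (suc k) ≤ a k

module _ {a : ℕ → ℕ} {peak : ℕ} (unimodal : Unimodal a peak) where
  open Unimodal unimodal

  ascending-≤ : ∀ {i j} → i ≤ j → j ≤ peak → a i ≤ a j
  ascending-≤ {i} i≤j = go (≤⇒≤′ i≤j)
    where
    go : ∀ {j} → i ≤′ j → j ≤ peak → a i ≤ a j
    go ≤′-refl          _        = ≤-refl
    go (≤′-step i≤′j) 1+j≤peak = ≤-trans (go i≤′j (<⇒≤ 1+j≤peak)) (ascending 1+j≤peak)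

  descending-≤ : ∀ {i j} → peak ≤ i → i ≤ j → a j ≤ a i
  descending-≤ {i} peak≤i i≤j = go (≤⇒≤′ i≤j)
    where
    go : ∀ {j} → i ≤′ j → a j ≤ a i
    go ≤′-refl          = ≤-refl
    go (≤′-step i≤′j) = ≤-trans (descending (≤-trans peak≤i (≤′⇒≤ i≤′j))) (go i≤′j)

  ≤-peak : ∀ k → a k ≤ a peak
  ≤-peak k with ≤-total k peak
  ... | inj₁ k≤peak = ascending-≤ k≤peak ≤-refl
  ... | inj₂ peak≤k = descending-≤ ≤-refl peak≤k

  ∑-descending-interleaved-≤ : ∀ J (x y : ℕ → ℕ) → (∀ j → x j ≤ y j) → (∀ j → y j ≤ x (suc j)) →
                               peak ≤ y 0 → ∑ J (a ∘ x ∘ suc) ≤ ∑ J (a ∘ y)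
  ∑-descending-interleaved-≤ zero    x y x≤y y≤x′ peak≤y₀ = z≤n
  ∑-descending-interleaved-≤ (suc J) x y x≤y y≤x′ peak≤y₀ =
    +-mono-≤ (descending-≤ peak≤y₀ (y≤x′ 0))
             (∑-descending-interleaved-≤ J (x ∘ suc) (y ∘ suc) (x≤y ∘ suc) (y≤x′ ∘ suc)
               (≤-trans peak≤y₀ (≤-trans (y≤x′ 0) (x≤y 1))))

  -- Below the peak compare a (x j) with a (y j), beyond it with a (y (j - 1)):
  -- the single unmatched term is at most a peak.
  ∑-interleaved-≤ : ∀ J (x y : ℕ → ℕ) → (∀ j → x j ≤ y j) → (∀ j → y j ≤ x (suc j)) →
                    ∑ J (a ∘ x) ≤ a peak + ∑ J (a ∘ y)
  ∑-interleaved-≤ zero    x y x≤y y≤x′ = z≤n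
  ∑-interleaved-≤ (suc J) x y x≤y y≤x′ with y 0 ≤? peak
  ... | yes y₀≤peak = begin
    a (x 0) + ∑ J (a ∘ x ∘ suc)             ≤⟨ +-mono-≤ (ascending-≤ (x≤y 0) y₀≤peak)
                                                 (∑-interleaved-≤ J (x ∘ suc) (y ∘ suc) (x≤y ∘ suc) (y≤x′ ∘ suc)) ⟩
    a (y 0) + (a peak + ∑ J (a ∘ y ∘ suc))  ≡⟨ x∙yz≈y∙xz +-commutativeSemigroup (a (y 0)) (a peak) _ ⟩
    a peak + ∑ (suc J) (a ∘ y)              ∎
  ... | no y₀≰peak = begin
    a (x 0) + ∑ J (a ∘ x ∘ suc)  ≤⟨ +-mono-≤ (≤-peak (x 0))
                                      (∑-descending-interleaved-≤ J x y x≤y y≤x′ (<⇒≤ (≰⇒> y₀≰peak))) ⟩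
    a peak + ∑ J (a ∘ y)         ≤⟨ +-monoʳ-≤ (a peak) (∑-monoˡ-≤ (a ∘ y) (n≤1+n J)) ⟩
    a peak + ∑ (suc J) (a ∘ y)   ∎

  ∑-onMultiplesOf-≤ : ∀ m .{{_ : NonZero m}} n → (∀ {k} → n < k → a k ≡ 0) →
                      m * ∑ (suc n) (onMultiplesOf m a) ≤ ∑ (suc n) a + m * a peak
  ∑-onMultiplesOf-≤ m n vanish = begin
    m * ∑ (suc n) (onMultiplesOf m a)    ≡⟨ cong (m *_) (∑-extend _ onMultiplesOf-vanish n<[n+1]*m) ⟨
    m * ∑ (suc n * m) (onMultiplesOf m a) ≡⟨ cong (m *_) (∑-onMultiplesOf (suc n) m a) ⟩
    m * T                                ≡⟨ ∑-const m T ⟨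
    ∑ m (λ _ → T)                        ≤⟨ ∑-monoʳ-≤ m (λ r<m → ∑-interleaved-≤ (suc n) (_* m) (λ j → j * m + _)
                                              (λ j → m≤m+n (j * m) _) (λ j → residue≤ j (<⇒≤ r<m))) ⟩
    ∑ m (λ r → a peak + ∑ (suc n) (λ j → a (j * m + r)))
                                         ≡⟨ ∑-distrib-+ m _ _ ⟩
    ∑ m (λ _ → a peak) + ∑ m (λ r → ∑ (suc n) (λ j → a (j * m + r)))
                                         ≡⟨ cong₂ _+_ (∑-const m (a peak)) (sym (∑-residues (suc n) m a)) ⟩
    m * a peak + ∑ (suc n * m) a         ≡⟨ cong (_+_ (m * a peak)) (∑-extend a vanish n<[n+1]*m) ⟩
    m * a peak + ∑ (suc n) a             ≡⟨ +-comm (m * a peak) _ ⟩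
    ∑ (suc n) a + m * a peak             ∎
    where
    T = ∑ (suc n) (λ j → a (j * m))
    n<[n+1]*m : n < suc n * m
    n<[n+1]*m = m≤m*n (suc n) m
    onMultiplesOf-vanish : ∀ {k} → n < k → onMultiplesOf m a k ≡ 0
    onMultiplesOf-vanish {k} n<k = onMultiplesOf-zero m a k (vanish n<k)
    residue≤ : ∀ j {r} → r ≤ m → j * m + r ≤ suc j * m
    residue≤ j r≤m = ≤-trans (+-monoʳ-≤ (j * m) r≤m) (≤-reflexive (+-comm (j * m) m))

[k+1]*[n+1]C[k+1]≡[n+1]*nCk : ∀ n k → suc k * (suc n C suc k) ≡ suc n * (n C k)
[k+1]*[n+1]C[k+1]≡[n+1]*nCk n zero = begin-equality
  1 * (suc n C 1)  ≡⟨ *-identityˡ _ ⟩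
  suc n C 1        ≡⟨ nC1≡n (suc n) ⟩
  suc n            ≡⟨ *-identityʳ (suc n) ⟨
  suc n * 1        ∎
[k+1]*[n+1]C[k+1]≡[n+1]*nCk zero    (suc k) = *-zeroʳ (suc (suc k))
[k+1]*[n+1]C[k+1]≡[n+1]*nCk (suc n) (suc k) = begin-equality
  suc (suc k) * (suc (suc n) C suc (suc k))
    ≡⟨ cong (suc (suc k) *_) (nCk+nC[k+1]≡[n+1]C[k+1] (suc n) (suc k)) ⟨
  suc (suc k) * (suc n C suc k + suc n C suc (suc k))
    ≡⟨ distribute (suc k) (suc n C suc k) (suc n C suc (suc k)) ⟩
  suc k * (suc n C suc k) + suc n C suc k + suc (suc k) * (suc n C suc (suc k))
    ≡⟨ cong₂ (λ u v → u + suc n C suc k + v) ([k+1]*[n+1]C[k+1]≡[n+1]*nCk n k)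
                                              ([k+1]*[n+1]C[k+1]≡[n+1]*nCk n (suc k)) ⟩
  suc n * (n C k) + suc n C suc k + suc n * (n C suc k)
    ≡⟨ collect (suc n) (n C k) (suc n C suc k) (n C suc k) ⟩
  suc n * (n C k + n C suc k) + suc n C suc k
    ≡⟨ cong (λ u → suc n * u + suc n C suc k) (nCk+nC[k+1]≡[n+1]C[k+1] n k) ⟩
  suc n * (suc n C suc k) + suc n C suc k
    ≡⟨ +-comm (suc n * (suc n C suc k)) _ ⟩
  suc (suc n) * (suc n C suc k) ∎
  where
  distribute : ∀ s b c → suc s * (b + c) ≡ s * b + b + suc s * c
  distribute = solve-∀
  collect : ∀ s b c d → s * b + c + s * d ≡ s * (b + d) + c
  collect = solve-∀

[k+1]*nC[k+1]+[k+1]*nCk≡[n+1]*nCk : ∀ n k → suc k * (n C suc k) + suc k * (n C k) ≡ suc n * (n C k)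
[k+1]*nC[k+1]+[k+1]*nCk≡[n+1]*nCk n k = begin-equality
  suc k * (n C suc k) + suc k * (n C k)  ≡⟨ *-distribˡ-+ (suc k) (n C suc k) (n C k) ⟨
  suc k * (n C suc k + n C k)            ≡⟨ cong (suc k *_) (+-comm (n C suc k) (n C k)) ⟩
  suc k * (n C k + n C suc k)            ≡⟨ cong (suc k *_) (nCk+nC[k+1]≡[n+1]C[k+1] n k) ⟩
  suc k * (suc n C suc k)                ≡⟨ [k+1]*[n+1]C[k+1]≡[n+1]*nCk n k ⟩
  suc n * (n C k)                        ∎

[1+k]+[1+k]≡2+[k+k] : ∀ k → suc k + suc k ≡ suc (suc (k + k))
[1+k]+[1+k]≡2+[k+k] k = cong suc (+-suc k k)

nCk≤nC[k+1] : ∀ {n k} → k + k < n → n C k ≤ n C suc k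
nCk≤nC[k+1] {n} {k} 2k<n = *-cancelˡ-≤ (suc k) (+-cancelʳ-≤ (suc k * (n C k)) _ _ (begin
  suc k * (n C k) + suc k * (n C k)      ≡⟨ *-distribʳ-+ (n C k) (suc k) (suc k) ⟨
  (suc k + suc k) * (n C k)              ≤⟨ *-monoˡ-≤ (n C k) 2k+2≤n+1 ⟩
  suc n * (n C k)                        ≡⟨ [k+1]*nC[k+1]+[k+1]*nCk≡[n+1]*nCk n k ⟨
  suc k * (n C suc k) + suc k * (n C k)  ∎))
  where
  2k+2≤n+1 : suc k + suc k ≤ suc n
  2k+2≤n+1 = ≤-trans (≤-reflexive ([1+k]+[1+k]≡2+[k+k] k)) (s≤s 2k<n)

nC[k+1]≤nCk : ∀ {n k} → n ≤ suc (k + k) → n C suc k ≤ n C k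
nC[k+1]≤nCk {n} {k} n≤2k+1 = *-cancelˡ-≤ (suc k) (+-cancelʳ-≤ (suc k * (n C k)) _ _ (begin
  suc k * (n C suc k) + suc k * (n C k)  ≡⟨ [k+1]*nC[k+1]+[k+1]*nCk≡[n+1]*nCk n k ⟩
  suc n * (n C k)                        ≤⟨ *-monoˡ-≤ (n C k) n+1≤2k+2 ⟩
  (suc k + suc k) * (n C k)              ≡⟨ *-distribʳ-+ (n C k) (suc k) (suc k) ⟩
  suc k * (n C k) + suc k * (n C k)      ∎))
  where
  n+1≤2k+2 : suc n ≤ suc k + suc k
  n+1≤2k+2 = ≤-trans (s≤s n≤2k+1) (≤-reflexive (sym ([1+k]+[1+k]≡2+[k+k] k)))

binomial-unimodal : ∀ {n h} → n ≡ h + h ⊎ n ≡ suc (h + h) → Unimodal (n C_) h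
binomial-unimodal {n} {h} n≡2h+b = record
  { ascending  = λ k<h → nCk≤nC[k+1] (<-≤-trans (+-mono-< k<h k<h) 2h≤n)
  ; descending = λ h≤k → nC[k+1]≤nCk (≤-trans n≤2h+1 (s≤s (+-mono-≤ h≤k h≤k)))
  }
  where
  2h≤n : h + h ≤ n
  2h≤n = Sum.[ ≤-reflexive ∘ sym , (λ n≡2h+1 → ≤-trans (n≤1+n _) (≤-reflexive (sym n≡2h+1))) ] n≡2h+b
  n≤2h+1 : n ≤ suc (h + h)
  n≤2h+1 = Sum.[ (λ n≡2h → ≤-trans (≤-reflexive n≡2h) (n≤1+n _)) , ≤-reflexive ] n≡2h+b

∑-binomial : ∀ {n N} → n < N → ∑ N (n C_) ≡ 2 ^ n
∑-binomial {zero}  {suc N} _           = cong suc (∑-zero N (λ _ → refl))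
∑-binomial {suc n} {suc N} (s<s n<N) = begin-equality
  1 + ∑ N (λ k → suc n C suc k)               ≡⟨ cong suc (∑-cong N λ {k} _ → nCk+nC[k+1]≡[n+1]C[k+1] n k) ⟨
  1 + ∑ N (λ k → n C k + n C suc k)           ≡⟨ cong suc (∑-distrib-+ N (n C_) (λ k → n C suc k)) ⟩
  1 + (∑ N (n C_) + ∑ N (λ k → n C suc k))    ≡⟨ +-suc (∑ N (n C_)) _ ⟨
  ∑ N (n C_) + ∑ (suc N) (n C_)               ≡⟨ cong₂ _+_ (∑-binomial n<N) (∑-binomial (m<n⇒m<1+n n<N)) ⟩
  2 ^ n + 2 ^ n                               ≡⟨ cong (_+_ (2 ^ n)) (+-identityʳ (2 ^ n)) ⟨
  2 ^ suc n                                   ∎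

[2k+1]Ck≡[2k+1]C[k+1] : ∀ k → suc (k + k) C k ≡ suc (k + k) C suc k
[2k+1]Ck≡[2k+1]C[k+1] k = trans (nCk≡nC[n∸k] (m≤n+m k (suc k))) (cong (suc (k + k) C_) (m+n∸n≡m (suc k) k))

[2k+2]C[k+1]≡2*[2k+1]Ck : ∀ k → (suc k + suc k) C suc k ≡ 2 * (suc (k + k) C k)
[2k+2]C[k+1]≡2*[2k+1]Ck k = begin-equality
  (suc k + suc k) C suc k                 ≡⟨ cong (_C suc k) ([1+k]+[1+k]≡2+[k+k] k) ⟩
  suc (suc (k + k)) C suc k               ≡⟨ nCk+nC[k+1]≡[n+1]C[k+1] (suc (k + k)) k ⟨
  suc (k + k) C k + suc (k + k) C suc k   ≡⟨ cong (_+_ (suc (k + k) C k)) ([2k+1]Ck≡[2k+1]C[k+1] k) ⟨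
  suc (k + k) C k + suc (k + k) C k       ≡⟨ cong (_+_ (suc (k + k) C k)) (+-identityʳ _) ⟨
  2 * (suc (k + k) C k)                   ∎

[k+1]*[2k+2]C[k+1]≡2*[2k+1]*2kCk : ∀ k → suc k * ((suc k + suc k) C suc k) ≡ 2 * suc (k + k) * ((k + k) C k)
[k+1]*[2k+2]C[k+1]≡2*[2k+1]*2kCk k = begin-equality
  suc k * ((suc k + suc k) C suc k)        ≡⟨ cong (suc k *_) ([2k+2]C[k+1]≡2*[2k+1]Ck k) ⟩
  suc k * (2 * (suc (k + k) C k))          ≡⟨ x∙yz≈y∙xz *-commutativeSemigroup (suc k) 2 (suc (k + k) C k) ⟩
  2 * (suc k * (suc (k + k) C k))          ≡⟨ cong (λ c → 2 * (suc k * c)) ([2k+1]Ck≡[2k+1]C[k+1] k) ⟩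
  2 * (suc k * (suc (k + k) C suc k))      ≡⟨ cong (2 *_) ([k+1]*[n+1]C[k+1]≡[n+1]*nCk (k + k) k) ⟩
  2 * (suc (k + k) * ((k + k) C k))        ≡⟨ *-assoc 2 (suc (k + k)) _ ⟨
  2 * suc (k + k) * ((k + k) C k)          ∎

2^[2k+2]≡4*2^[2k] : ∀ k → 2 ^ (suc k + suc k) ≡ 4 * 2 ^ (k + k)
2^[2k+2]≡4*2^[2k] k = trans (cong (2 ^_) ([1+k]+[1+k]≡2+[k+k] k)) (sym (*-assoc 2 2 (2 ^ (k + k))))

-- The step k ↦ k + 1 multiplies the left side by 4 (2k + 1) (2k + 3) / (k + 1)² < 16.
central-binomial-bound : ∀ k → ((k + k) C k) * ((k + k) C k) * suc (k + k) ≤ 2 ^ (k + k) * 2 ^ (k + k)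
central-binomial-bound zero    = ≤-refl
central-binomial-bound (suc k) = *-cancelˡ-≤ (s * s) (begin
  s * s * (X′ * X′ * suc (s + s))                ≡⟨ regroup s X′ (suc (s + s)) ⟩
  s * X′ * (s * X′) * suc (s + s)                ≡⟨ cong (λ u → u * u * suc (s + s)) ([k+1]*[2k+2]C[k+1]≡2*[2k+1]*2kCk k) ⟩
  c * X * (c * X) * suc (s + s)                  ≡⟨ cong (λ u → c * X * (c * X) * u) (cong suc ([1+k]+[1+k]≡2+[k+k] k)) ⟩
  c * X * (c * X) * (3 + (k + k))                ≡⟨ factor X (k + k) ⟩
  4 * (1 + (k + k)) * (3 + (k + k)) * (X * X * suc (k + k))
                                                 ≤⟨ *-monoʳ-≤ (4 * (1 + (k + k)) * (3 + (k + k))) (central-binomial-bound k) ⟩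
  4 * (1 + (k + k)) * (3 + (k + k)) * (P * P)    ≤⟨ *-monoˡ-≤ (P * P) (≤-trans (m≤m+n _ 4) (≤-reflexive (sixteen k))) ⟩
  s * s * 16 * (P * P)                           ≡⟨ powers s P ⟩
  s * s * ((4 * P) * (4 * P))                    ≡⟨ cong (λ u → s * s * (u * u)) (2^[2k+2]≡4*2^[2k] k) ⟨
  s * s * (2 ^ (s + s) * 2 ^ (s + s))            ∎)
  where
  s = suc k
  X = (k + k) C k
  X′ = (s + s) C s
  c = 2 * suc (k + k)
  P = 2 ^ (k + k)
  regroup : ∀ s x t → s * s * (x * x * t) ≡ s * x * (s * x) * t
  regroup = solve-∀
  factor : ∀ x e → 2 * (1 + e) * x * (2 * (1 + e) * x) * (3 + e) ≡ 4 * (1 + e) * (3 + e) * (x * x * (1 + e))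
  factor = solve-∀
  sixteen : ∀ k → 4 * (1 + (k + k)) * (3 + (k + k)) + 4 ≡ (1 + k) * (1 + k) * 16
  sixteen = solve-∀
  powers : ∀ s p → s * s * 16 * (p * p) ≡ s * s * ((4 * p) * (4 * p))
  powers = solve-∀

middle-binomial-bound : ∀ {n h} → n ≡ h + h ⊎ n ≡ suc (h + h) → (n C h) * (n C h) * n ≤ 2 ^ n * 2 ^ n
middle-binomial-bound {h = k} (inj₁ refl) =
  ≤-trans (*-monoʳ-≤ (((k + k) C k) * ((k + k) C k)) (n≤1+n (k + k))) (central-binomial-bound k)
middle-binomial-bound {h = k} (inj₂ refl) = *-cancelˡ-≤ 4 (begin
  4 * (M * M * n)                       ≡⟨ double M n ⟩
  (2 * M) * (2 * M) * n                 ≡⟨ cong (λ u → u * u * n) ([2k+2]C[k+1]≡2*[2k+1]Ck k) ⟨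
  X′ * X′ * n                           ≤⟨ *-monoʳ-≤ (X′ * X′) (s≤s (+-mono-≤ (n≤1+n k) (n≤1+n k))) ⟩
  X′ * X′ * suc (suc k + suc k)         ≤⟨ central-binomial-bound (suc k) ⟩
  2 ^ (suc k + suc k) * 2 ^ (suc k + suc k)
                                        ≡⟨ cong (λ u → 2 ^ u * 2 ^ u) (+-suc (suc k) k) ⟩
  (2 * N) * (2 * N)                     ≡⟨ square-double N ⟩
  4 * (N * N)                           ∎)
  where
  n = suc (k + k)
  M = n C k
  N = 2 ^ n
  X′ = (suc k + suc k) C suc k
  double : ∀ x t → 4 * (x * x * t) ≡ (2 * x) * (2 * x) * t
  double = solve-∀
  square-double : ∀ x → (2 * x) * (2 * x) ≡ 4 * (x * x)
  square-double = solve-∀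

⌊n/2⌋-parity : ∀ n → n ≡ ⌊ n /2⌋ + ⌊ n /2⌋ ⊎ n ≡ suc (⌊ n /2⌋ + ⌊ n /2⌋)
⌊n/2⌋-parity zero          = inj₁ refl
⌊n/2⌋-parity (suc zero)    = inj₂ refl
⌊n/2⌋-parity (suc (suc n)) = Sum.map (λ e → trans (cong (suc ∘ suc) e) (sym ([1+k]+[1+k]≡2+[k+k] h)))
                                     (λ e → trans (cong (suc ∘ suc) e) (cong suc (sym ([1+k]+[1+k]≡2+[k+k] h))))
                                     (⌊n/2⌋-parity n)
  where h = ⌊ n /2⌋

toℚᵘ-/ : ∀ i d .{{_ : NonZero d}} → toℚᵘ (i / d) ≃ mkℚᵘ i (pred d)
toℚᵘ-/ i (suc d) = ℚP.toℚᵘ-fromℚᵘ (mkℚᵘ i d)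

+-mkℚᵘ-same : ∀ a b d → mkℚᵘ (+ a) d ℚᵘ.+ mkℚᵘ (+ b) d ≃ mkℚᵘ (+ (a + b)) d
+-mkℚᵘ-same a b d =
  *≡* (trans (distrib (+ a) (+ b) (+ suc d)) (sym (cong₂ ℤ._*_ (ℤP.pos-+ a b) (ℤP.pos-* (suc d) (suc d)))))
  where
  distrib : ∀ x y z → (x ℤ.* z ℤ.+ y ℤ.* z) ℤ.* z ≡ (x ℤ.+ y) ℤ.* (z ℤ.* z)
  distrib = ℤSolver.solve-∀

toℚᵘ-sumℚ : ∀ N {F : ℕ → ℚ} {f : ℕ → ℕ} d → (∀ k → toℚᵘ (F k) ≃ mkℚᵘ (+ f k) d) →
            toℚᵘ (sumℚ (applyUpTo F N)) ≃ mkℚᵘ (+ ∑ N f) d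
toℚᵘ-sumℚ zero    d F≃f = *≡* refl
toℚᵘ-sumℚ (suc N) {F} {f} d F≃f = ℚᵘP.≃-trans (ℚP.toℚᵘ-homo-+ (F 0) _)
  (ℚᵘP.≃-trans (ℚᵘP.+-cong (F≃f 0) (toℚᵘ-sumℚ N d (F≃f ∘ suc))) (+-mkℚᵘ-same (f 0) (∑ N (f ∘ suc)) d))

probDiv-fraction : ∀ m n → toℚᵘ (probDiv m n) ≃ mkℚᵘ (+ ∑ (suc n) (onMultiplesOf m (n C_))) (pred (2 ^ n))
probDiv-fraction m n =
  subst (λ xs → toℚᵘ (sumℚ xs) ≃ mkℚᵘ (+ ∑ (suc n) (onMultiplesOf m (n C_))) (pred (2 ^ n)))
        (sym (map-upTo F (suc n))) (toℚᵘ-sumℚ (suc n) (pred (2 ^ n)) term)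
  where
  F : ℕ → ℚ
  F k = if does (m ∣? k) then binomPMF n k else 0ℚ
  term : ∀ k → toℚᵘ (F k) ≃ mkℚᵘ (+ onMultiplesOf m (n C_) k) (pred (2 ^ n))
  term k with does (m ∣? k)
  ... | true  = toℚᵘ-/ (+ (n C k)) (2 ^ n) {{m^n≢0 2 n}}
  ... | false = *≡* refl

fraction-≤0 : ∀ {x} z q → toℚᵘ x ≃ mkℚᵘ z q → z ℤ.≤ + 0 → x ℚ.≤ 0ℚ
fraction-≤0 z q x≃ z≤0 =
  ℚP.toℚᵘ-cancel-≤ (ℚᵘP.≤-respˡ-≃ (ℚᵘP.≃-sym x≃) (*≤* (subst (ℤ._≤ + 0) (sym (ℤP.*-identityʳ z)) z≤0)))

fraction-square-≤ : ∀ {x} D q n a → toℚᵘ x ≃ mkℚᵘ (+ D) q → D * D * n ≤ a * a * (suc q * suc q) →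
                    x ℚ.* x ℚ.* (+ n / 1) ℚ.≤ + a / 1 ℚ.* (+ a / 1)
fraction-square-≤ {x} D q n a x≃ bound = ℚP.toℚᵘ-cancel-≤
  (ℚᵘP.≤-respʳ-≃ (ℚᵘP.≃-sym rhs≃) (ℚᵘP.≤-respˡ-≃ (ℚᵘP.≃-sym lhs≃) (*≤* (subst₂ ℤ._≤_ lhs-num rhs-num (ℤ.+≤+ bound′)))))
  where
  lhs≃ : toℚᵘ (x ℚ.* x ℚ.* (+ n / 1)) ≃ mkℚᵘ (+ D) q ℚᵘ.* mkℚᵘ (+ D) q ℚᵘ.* mkℚᵘ (+ n) 0
  lhs≃ = ℚᵘP.≃-trans (ℚP.toℚᵘ-homo-* (x ℚ.* x) _)
           (ℚᵘP.*-cong (ℚᵘP.≃-trans (ℚP.toℚᵘ-homo-* x x) (ℚᵘP.*-cong x≃ x≃)) (toℚᵘ-/ (+ n) 1))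
  rhs≃ : toℚᵘ (+ a / 1 ℚ.* (+ a / 1)) ≃ mkℚᵘ (+ a) 0 ℚᵘ.* mkℚᵘ (+ a) 0
  rhs≃ = ℚᵘP.≃-trans (ℚP.toℚᵘ-homo-* (+ a / 1) _) (ℚᵘP.*-cong (toℚᵘ-/ (+ a) 1) (toℚᵘ-/ (+ a) 1))
  bound′ : D * D * n * 1 ≤ a * a * (suc q * suc q * 1)
  bound′ = subst₂ _≤_ (sym (*-identityʳ _)) (cong (a * a *_) (sym (*-identityʳ _))) bound
  lhs-num : + (D * D * n * 1) ≡ + D ℤ.* + D ℤ.* + n ℤ.* + 1
  lhs-num = trans (ℤP.pos-* (D * D * n) 1) (cong (ℤ._* + 1) (trans (ℤP.pos-* (D * D) n) (cong (ℤ._* + n) (ℤP.pos-* D D))))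
  rhs-num : + (a * a * (suc q * suc q * 1)) ≡ + a ℤ.* + a ℤ.* + (suc q * suc q * 1)
  rhs-num = trans (ℤP.pos-* (a * a) _) (cong (ℤ._* + (suc q * suc q * 1)) (ℤP.pos-* a a))

LeDivSqrt-fraction : ∀ {x} A B q n a → toℚᵘ x ≃ mkℚᵘ (A ⊖ B) q →
                     (A ∸ B) * (A ∸ B) * n ≤ a * a * (suc q * suc q) → LeDivSqrt x (+ a / 1) n
LeDivSqrt-fraction A B q n a x≃ bound with ≤-total A B
... | inj₁ A≤B = inj₁ (fraction-≤0 (A ⊖ B) q x≃ (subst (ℤ._≤ + 0) (sym (ℤP.⊖-≤ A≤B)) ℤP.neg-≤-pos))
... | inj₂ B≤A = inj₂ (fraction-square-≤ (A ∸ B) q n a (subst (λ z → _ ≃ mkℚᵘ z q) (ℤP.⊖-≥ B≤A) x≃) bound)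

LeDivSqrt-S/N-1/m : ∀ {P} S N m M n .{{_ : NonZero N}} .{{_ : NonZero m}} →
                    toℚᵘ P ≃ mkℚᵘ (+ S) (pred N) → m * S ≤ N + m * M → M * M * n ≤ N * N →
                    LeDivSqrt (P - + 1 / m) (+ 2 / 1) n
LeDivSqrt-S/N-1/m {P} S N@(suc _) m@(suc _) M n P≃ mS≤N+mM M²n≤N² =
  LeDivSqrt-fraction (S * m) N (pred (N * m)) n 2 x≃ bound
  where
  numerator : + S ℤ.* + m ℤ.+ -[1+ 0 ] ℤ.* + N ≡ (S * m) ⊖ N
  numerator = trans (cong₂ ℤ._+_ (sym (ℤP.pos-* S m)) (ℤP.-1*i≡-i (+ N))) (ℤP.m-n≡m⊖n (S * m) N)
  x≃ : toℚᵘ (P - + 1 / m) ≃ mkℚᵘ ((S * m) ⊖ N) (pred (N * m))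
  x≃ = ℚᵘP.≃-trans (ℚP.toℚᵘ-homo-+ P _)
         (ℚᵘP.≃-trans (ℚᵘP.+-cong P≃ (ℚᵘP.≃-trans (ℚP.toℚᵘ-homo‿- (+ 1 / m)) (ℚᵘP.-‿cong (toℚᵘ-/ (+ 1) m))))
           (*≡* (cong (ℤ._* + (N * m)) numerator)))
  D≤mM : S * m ∸ N ≤ m * M
  D≤mM = m≤n+o⇒m∸n≤o (S * m) N (subst (_≤ N + m * M) (*-comm m S) mS≤N+mM)
  bound : (S * m ∸ N) * (S * m ∸ N) * n ≤ 2 * 2 * (N * m * (N * m))
  bound = begin
    (S * m ∸ N) * (S * m ∸ N) * n  ≤⟨ *-monoˡ-≤ n (*-mono-≤ D≤mM D≤mM) ⟩
    m * M * (m * M) * n            ≡⟨ regroup m M n ⟩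
    m * m * (M * M * n)            ≤⟨ *-monoʳ-≤ (m * m) M²n≤N² ⟩
    m * m * (N * N)                ≡⟨ regroup′ m N ⟩
    N * m * (N * m)                ≤⟨ m≤n*m _ 4 ⟩
    4 * (N * m * (N * m))          ∎
    where
    regroup : ∀ m M n → m * M * (m * M) * n ≡ m * m * (M * M * n)
    regroup = solve-∀
    regroup′ : ∀ m N → m * m * (N * N) ≡ N * m * (N * m)
    regroup′ = solve-∀

lemma2p2 : (m n : ℕ) → .{{_ : NonZero m}} → .{{_ : NonZero n}} →
    LeDivSqrt (probDiv m n - (+ 1 / m)) (+ 2 / 1) n
lemma2p2 m n = LeDivSqrt-S/N-1/m S (2 ^ n) m (n C h) n {{m^n≢0 2 n}}
  (probDiv-fraction m n) multiples-bound (middle-binomial-bound {h = h} (⌊n/2⌋-parity n))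
  where
  h = ⌊ n /2⌋
  S = ∑ (suc n) (onMultiplesOf m (n C_))
  multiples-bound : m * S ≤ 2 ^ n + m * (n C h)
  multiples-bound = subst (λ t → m * S ≤ t + m * (n C h)) (∑-binomial {n} ≤-refl)
    (∑-onMultiplesOf-≤ (binomial-unimodal {h = h} (⌊n/2⌋-parity n)) m n k>n⇒nCk≡0)
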